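{- The raw Shapley-Shubik power index $\mathrm{SS}^*$ (viewed as the function mapping an encoded pair $(G,i)$ of a weighted voting game and a player to $\mathrm{SS}^*(G,i)$) is not $\#\mathrm{P}$-parsimonious-complete.
   Context: An $n$-player weighted voting game $G=(w_1,\ldots,w_n;q)$ consists of nonnegative integer weights and a nonnegative integer quota; players are $N=\{1,\ldots,n\}$. For $S\subseteq N$, $\mathrm{succ}_G(S)=1$ if $\sum_{i\in S}w_i\ge q$ and $0$ otherwise. The raw Shapley-Shubik index is $\mathrm{SS}^*(G,i)=\sum_{S\subseteq N\setminus\{i\}}|S|!\,(n-|S|-1)!\,(\mathrm{succ}_G(S\cup\{i\})-\mathrm{succ}_G(S))$. $\#\mathrm{P}$ is the class of functions $f:\{0,1\}^*\to\mathbb{N}$ for which there is a nondeterministic polynomial-time Turing machine whose number of accepting paths on $x$ equals $f(x)$. $g$ parsimoniously reduces to $f$ if there is a polynomial-time computable $\varphi$ with $g(x)=f(\varphi(x))$ for all $x$; $f$ is $\#\mathrm{P}$-parsimonious-complete if $f\in\#\mathrm{P}$ and every function in $\#\mathrm{P}$ parsimoniously reduces to $f$. -}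

module Defs where

open import Data.Bool using (Bool; true; false; if_then_else_; _∧_)
open import Data.Nat using (ℕ; zero; suc; _+_; _*_; _∸_; _^_; _≤_; _<_; _≤?_; _<?_; _!)
open import Data.Fin using (Fin; zero; suc; fromℕ<)
open import Data.Fin.Subset using (Subset; inside; outside; ∣_∣; ⁅_⁆; _∪_)
open import Data.Vec using (Vec; []; _∷_; lookup; fromList)
open import Data.List using (List; []; _∷_; _++_; map; length; filter)
open import Data.Nat.ListAction using (sum)
open import Data.Maybe using (Maybe; just; nothing)
open import Data.Product using (Σ; ∃; _×_; _,_)
open import Data.Unit using (⊤)
open import Data.Empty using (⊥)
open import Relation.Nullary using (¬_; yes; no)
open import Relation.Nullary.Decidable using (⌊_⌋)
open import Relation.Binary.PropositionalEquality using (_≡_)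

record WVG (n : ℕ) : Set where
  constructor wvg
  field
    weights : Vec ℕ n
    quota   : ℕ
open WVG public

weightOf : ∀ {n} → Vec ℕ n → Subset n → ℕ
weightOf []       []              = 0
weightOf (w ∷ ws) (true  ∷ S) = w + weightOf ws S
weightOf (w ∷ ws) (false ∷ S) = weightOf ws S

succG : ∀ {n} → WVG n → Subset n → ℕ
succG G S = if ⌊ quota G ≤? weightOf (weights G) S ⌋ then 1 else 0

allSubsets : (n : ℕ) → List (Subset n)
allSubsets zero    = [] ∷ []
allSubsets (suc n) = map (outside ∷_) (allSubsets n) ++ map (inside ∷_) (allSubsets n)

notIn : ∀ {n} → Fin n → Subset n → Bool
notIn i S = if lookup S i then false else true

-- Raw Shapley-Shubik index:
-- SS*(G,i) = Σ_{S ⊆ N∖{i}} |S|! (n-|S|-1)! (succ_G(S∪{i}) - succ_G(S)).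
-- (Weights are nonnegative, so the difference is 0 or 1 and ∸ is exact.)
SS* : ∀ {n} → WVG n → Fin n → ℕ
SS* {n} G i =
  sum (map (λ S → (∣ S ∣ !) * ((n ∸ ∣ S ∣ ∸ 1) !) * (succG G (S ∪ ⁅ i ⁆) ∸ succG G S))
           (filter (λ S → notIn i S ≡? true) (allSubsets n)))
  where
    open import Data.Bool.Properties using () renaming (_≟_ to _≡?_)

-- Encoding of pairs (G,i) as binary strings
-- A list of naturals is encoded by writing each number in binary
-- (least significant bit first) with every bit doubled (0 ↦ 00, 1 ↦ 11),
-- followed by the separator 01.  The pair (G,i) with
-- G = (w_1,...,w_n; q) and player i (0-based index j = i-1) is encoded as
-- the list  q , j , w_1 , ... , w_n.

Bits : Set
Bits = List Bool

decodeNats : Bits → Maybe (List ℕ)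
decodeNats = go 0 1
  where
    -- acc: value read so far of the current number, pw: current power of 2
    go : ℕ → ℕ → Bits → Maybe (List ℕ)
    go acc pw []                        = if ⌊ pw ≤? 1 ⌋ then just [] else nothing
    go acc pw (false ∷ false ∷ xs)      = go acc (2 * pw) xs
    go acc pw (true  ∷ true  ∷ xs)      = go (acc + pw) (2 * pw) xs
    go acc pw (false ∷ true  ∷ xs)      with go 0 1 xs
    ... | just ns = just (acc ∷ ns)
    ... | nothing = nothing
    go acc pw (true  ∷ false ∷ xs)      = nothing
    go acc pw (_ ∷ [])                  = nothing

-- SS* as a function on {0,1}*: malformed strings are mapped to 0.
SSstr : Bits → ℕ
SSstr x with decodeNats x
... | just (q ∷ j ∷ ws) with j <? length ws
...   | yes j<n = SS* (wvg (fromList ws) q) (fromℕ< j<n)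
...   | no  _   = 0
SSstr x | just _  = 0
SSstr x | nothing = 0

-- Turing machines (single tape, two-way infinite)
-- Tape alphabet Fin (3 + k): zero = blank, 1 = bit 0, 2 = bit 1, others extra.

data Move : Set where
  left right stay : Move

record Tape (Γ : Set) : Set where
  constructor tape
  field
    lefts  : List Γ   -- cells to the left of the head, nearest first
    here   : Γ
    rights : List Γ   -- cells to the right of the head, nearest first

module _ {k : ℕ} where
  Sym : Set
  Sym = Fin (3 + k)

  blank : Sym
  blank = zero

  bitSym : Bool → Sym
  bitSym false = suc zero
  bitSym true  = suc (suc zero)

  moveTape : Move → Tape Sym → Tape Sym
  moveTape left  (tape []       h rs) = tape [] blank (h ∷ rs)
  moveTape left  (tape (l ∷ ls) h rs) = tape ls l (h ∷ rs)
  moveTape right (tape ls h [])       = tape (h ∷ ls) blank []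
  moveTape right (tape ls h (r ∷ rs)) = tape (h ∷ ls) r rs
  moveTape stay  t                    = t

  writeTape : Sym → Tape Sym → Tape Sym
  writeTape a (tape ls _ rs) = tape ls a rs

  initTape : Bits → Tape Sym
  initTape []       = tape [] blank []
  initTape (b ∷ bs) = tape [] (bitSym b) (Data.List.map bitSym bs)

  readBits : List Sym → Bits
  readBits []                          = []
  readBits (suc zero ∷ xs)             = false ∷ readBits xs
  readBits (suc (suc zero) ∷ xs)       = true ∷ readBits xs
  readBits (_ ∷ xs)                    = []

  output : Tape Sym → Bits
  output (tape _ h rs) = readBits (h ∷ rs)

-- Nondeterministic TM: states Fin s, start state zero; it halts when there
-- is no applicable transition, and accepts iff it halts in an accepting state.
record NTM : Set where
  field
    s k    : ℕ
    δ      : Fin (suc s) → Fin (3 + k) → List (Fin (suc s) × Fin (3 + k) × Move)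
    accept : Fin (suc s) → Bool

module _ (M : NTM) where
  open NTM M

  Config : Set
  Config = Fin (suc s) × Tape (Fin (3 + k))

  apply : Fin (suc s) × Fin (3 + k) × Move → Tape (Fin (3 + k)) → Config
  apply (q , a , m) t = q , moveTape m (writeTape a t)

  initN : Bits → Config
  initN x = zero , initTape x

  mutual
    accPaths : ℕ → Config → ℕ
    accPaths fuel (q , t) = accPathsL fuel q t (δ q (Tape.here t))

    accPathsL : ℕ → Fin (suc s) → Tape (Fin (3 + k)) →
                List (Fin (suc s) × Fin (3 + k) × Move) → ℕ
    accPathsL fuel     q t []          = if accept q then 1 else 0
    accPathsL zero     q t (_ ∷ _)     = 0
    accPathsL (suc f)  q t (tr ∷ trs)  = accPaths f (apply tr t) + accPathsL′ f t trs

    accPathsL′ : ℕ → Tape (Fin (3 + k)) → List (Fin (suc s) × Fin (3 + k) × Move) → ℕ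
    accPathsL′ f t []         = 0
    accPathsL′ f t (tr ∷ trs) = accPaths f (apply tr t) + accPathsL′ f t trs

  mutual
    haltsWithin : ℕ → Config → Set
    haltsWithin fuel (q , t) = haltsL fuel t (δ q (Tape.here t))

    haltsL : ℕ → Tape (Fin (3 + k)) → List (Fin (suc s) × Fin (3 + k) × Move) → Set
    haltsL fuel    t []         = ⊤
    haltsL zero    t (_ ∷ _)    = ⊥
    haltsL (suc f) t (tr ∷ trs) = haltsWithin f (apply tr t) × haltsAll f t trs

    haltsAll : ℕ → Tape (Fin (3 + k)) → List (Fin (suc s) × Fin (3 + k) × Move) → Set
    haltsAll f t []         = ⊤
    haltsAll f t (tr ∷ trs) = haltsWithin f (apply tr t) × haltsAll f t trs

record DTM : Set where
  field
    s k : ℕ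
    δ   : Fin (suc s) → Fin (3 + k) → Maybe (Fin (suc s) × Fin (3 + k) × Move)

module _ (M : DTM) where
  open DTM M

  runD : ℕ → Fin (suc s) → Tape (Fin (3 + k)) → Maybe (Tape (Fin (3 + k)))
  runD fuel q t with δ q (Tape.here t)
  ... | nothing = just t
  runD zero    q t | just _ = nothing
  runD (suc f) q t | just (q′ , a , m) = runD f q′ (moveTape m (writeTape a t))

polyBound : ℕ → ℕ → ℕ → ℕ
polyBound c d len = c * len ^ d + c

SharpP : (Bits → ℕ) → Set
SharpP f = Σ NTM λ M → Σ ℕ λ c → Σ ℕ λ d →
  ((x : Bits) → haltsWithin M (polyBound c d (length x)) (initN M x)) ×
  ((x : Bits) → accPaths M (polyBound c d (length x)) (initN M x) ≡ f x)

PolyTimeComputable : (Bits → Bits) → Set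
PolyTimeComputable φ = Σ DTM λ M → Σ ℕ λ c → Σ ℕ λ d → (x : Bits) →
  Σ (Tape (Fin (3 + DTM.k M))) λ t →
    (runD M (polyBound c d (length x)) zero (initTape x) ≡ just t) × (output t ≡ φ x)

_≤ₚₐᵣ_ : (Bits → ℕ) → (Bits → ℕ) → Set
g ≤ₚₐᵣ f = Σ (Bits → Bits) λ φ → PolyTimeComputable φ × ((x : Bits) → g x ≡ f (φ x))

SharpP-parsimonious-complete : (Bits → ℕ) → Set
SharpP-parsimonious-complete f = SharpP f × ((g : Bits → ℕ) → SharpP g → g ≤ₚₐᵣ f)

module Submission where

-- A parsimonious reduction preserves values: if every #P function g
-- reduces to f via some φ, then g x = f (φ x), so the range of f contains
-- the range of every #P function.  Constant functions are in #P (a machine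
-- that branches c times into an accepting state has exactly c accepting
-- paths), hence a #P-parsimonious-complete function is onto ℕ.  But SS*
-- never takes the value 7:
--   * for n ≥ 4 players every coefficient |S|!(n-|S|-1)! is even (one of
--     the two factorials has argument at least 2), so SS*(G,i) is even;
--   * for n ≤ 3 players SS*(G,i) is at most the sum of the coefficients,
--     which is at most 6 (by computation; in fact it equals n!).
-- The string version SSstr is 0 on malformed input and SS*(G,i) otherwise,
-- so 7 is not in its range either.

open import Defs
open import Data.Bool using (Bool; true; false)
open import Data.Bool.Properties using () renaming (_≟_ to _≟ᵇ_)
open import Data.Nat
open import Data.Nat.Properties
open import Data.Nat.Divisibility using (_∣_; _∣?_; _∣0; ∣m∣n⇒∣m+n; ∣m⇒∣m*n; ∣⇒≤; ∣n⇒∣m*n; m≤n⇒m!∣n!)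
open import Data.Nat.ListAction using (sum)
open import Data.List using (List; []; _∷_; map; filter; length; replicate)
open import Data.Fin using (Fin; zero; suc; fromℕ<)
open import Data.Fin.Subset using (Subset; ∣_∣; ⁅_⁆; _∪_)
open import Data.Vec using (fromList)
open import Data.Maybe using (just; nothing)
open import Data.Product using (Σ; _×_; _,_)
open import Data.Sum using (_⊎_; inj₁; inj₂)
open import Relation.Nullary using (¬_; yes; no)
open import Relation.Nullary.Decidable using (from-no)
open import Relation.Binary.PropositionalEquality using (_≡_; _≢_; refl; sym; trans; subst; cong)

-- A two-state machine whose start state branches, on any symbol, into c
-- copies of a halting accepting state: it has exactly c accepting paths.
module ConstantMachine (c : ℕ) where

  branch : Fin 2 × Fin 3 × Move
  branch = suc zero , zero , stay

  transitions : Fin 2 → Fin 3 → List (Fin 2 × Fin 3 × Move)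
  transitions zero       _ = replicate c branch
  transitions (suc zero) _ = []

  accepting : Fin 2 → Bool
  accepting zero       = false
  accepting (suc zero) = true

  machine : NTM
  machine = record { s = 1 ; k = 0 ; δ = transitions ; accept = accepting }

  branches-halt : ∀ f t n → haltsAll machine f t (replicate n branch)
  branches-halt f t zero    = _
  branches-halt f t (suc n) = _ , branches-halt f t n

  branches-count : ∀ f t n → accPathsL′ machine f t (replicate n branch) ≡ n
  branches-count f t zero    = refl
  branches-count f t (suc n) = cong suc (branches-count f t n)

  -- From the start state, whose transition list is replicate c branch, two
  -- steps of fuel (the polynomial bound 1·|x|⁰ + 1) suffice on every input.
  halts : ∀ t n → haltsL machine 2 t (replicate n branch)
  halts t zero    = _
  halts t (suc n) = _ , branches-halt 1 t n

  counts : ∀ t n → accPathsL machine 2 zero t (replicate n branch) ≡ n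
  counts t zero    = refl
  counts t (suc n) = cong suc (branches-count 1 t n)

constant-∈-#P : ∀ c → SharpP (λ _ → c)
constant-∈-#P c = machine , 1 , 0 , (λ x → halts (initTape x) c) , (λ x → counts (initTape x) c)
  where open ConstantMachine c

-- Parsimonious reductions preserve values, so a #P-parsimonious-complete
-- function attains every value of every #P function, in particular every c.
complete⇒onto : ∀ {f} → SharpP-parsimonious-complete f → ∀ c → Σ Bits λ x → f x ≡ c
complete⇒onto (_ , reduce) c with reduce (λ _ → c) (constant-∈-#P c)
... | φ , _ , preserves = φ [] , sym (preserves [])

coefficient : ℕ → ℕ → ℕ
coefficient n s = s ! * (n ∸ s ∸ 1) !

coalitionsWithout : ∀ {n} → Fin n → List (Subset n)
coalitionsWithout {n} i = filter (λ S → notIn i S ≟ᵇ true) (allSubsets n)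

coefficientSum : ∀ {n} → Fin n → ℕ
coefficientSum {n} i = sum (map (λ S → coefficient n ∣ S ∣) (coalitionsWithout i))

sum-map-mono : ∀ {A : Set} (f g : A → ℕ) (xs : List A) →
               (∀ x → f x ≤ g x) → sum (map f xs) ≤ sum (map g xs)
sum-map-mono f g []       f≤g = z≤n
sum-map-mono f g (x ∷ xs) f≤g = +-mono-≤ (f≤g x) (sum-map-mono f g xs f≤g)

sum-map-∣ : ∀ {A : Set} {d} (f : A → ℕ) (xs : List A) →
            (∀ x → d ∣ f x) → d ∣ sum (map f xs)
sum-map-∣ {d = d} f [] d∣f = d ∣0
sum-map-∣ f (x ∷ xs) d∣f = ∣m∣n⇒∣m+n (d∣f x) (sum-map-∣ f xs d∣f)

succG≤1 : ∀ {n} (G : WVG n) S → succG G S ≤ 1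
succG≤1 G S with quota G ≤? weightOf (weights G) S
... | yes _ = ≤-refl
... | no  _ = z≤n

marginal≤1 : ∀ {n} (G : WVG n) S T → succG G S ∸ succG G T ≤ 1
marginal≤1 G S T = ≤-trans (m∸n≤m (succG G S) (succG G T)) (succG≤1 G S)

SS*≤coefficientSum : ∀ {n} (G : WVG n) (i : Fin n) → SS* G i ≤ coefficientSum i
SS*≤coefficientSum {n} G i = sum-map-mono _ _ (coalitionsWithout i) term≤coefficient
  where
    term≤coefficient : ∀ S → coefficient n ∣ S ∣ * (succG G (S ∪ ⁅ i ⁆) ∸ succG G S)
                             ≤ coefficient n ∣ S ∣
    term≤coefficient S = ≤-trans (*-monoʳ-≤ (coefficient n ∣ S ∣) (marginal≤1 G (S ∪ ⁅ i ⁆) S))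
                                 (≤-reflexive (*-identityʳ _))

factorial-even : ∀ m → 2 ∣ (2 + m) !
factorial-even m = m≤n⇒m!∣n! {2} {2 + m} (s≤s (s≤s z≤n))

-- With at least four players every coefficient s!(n-s-1)! is even: either
-- s ≥ 2, or n ∸ s ∸ 1 ≥ 2.
coefficient-even : ∀ {n} → 4 ≤ n → ∀ s → 2 ∣ coefficient n s
coefficient-even (s≤s (s≤s (s≤s (s≤s {n = m} _)))) zero =
  ∣n⇒∣m*n 1 (factorial-even (suc m))
coefficient-even (s≤s (s≤s (s≤s (s≤s {n = m} _)))) (suc zero) =
  ∣n⇒∣m*n 1 (factorial-even m)
coefficient-even _ (suc (suc s)) = ∣m⇒∣m*n _ (factorial-even s)

SS*-even : ∀ {n} → 4 ≤ n → (G : WVG n) (i : Fin n) → 2 ∣ SS* G i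
SS*-even 4≤n G i = sum-map-∣ _ (coalitionsWithout i)
  (λ S → ∣m⇒∣m*n _ (coefficient-even 4≤n ∣ S ∣))

-- With at most three players the coefficients sum to n!, by computation
-- (the identity holds for every n, but only n ≤ 3 is needed here).
coefficientSum-small : ∀ {n} (i : Fin n) → n ≤ 3 → coefficientSum i ≡ n !
coefficientSum-small {1} zero             _ = refl
coefficientSum-small {2} zero             _ = refl
coefficientSum-small {2} (suc zero)       _ = refl
coefficientSum-small {3} zero             _ = refl
coefficientSum-small {3} (suc zero)       _ = refl
coefficientSum-small {3} (suc (suc zero)) _ = refl
coefficientSum-small {suc (suc (suc (suc _)))} _ (s≤s (s≤s (s≤s ())))

SS*≤6 : ∀ {n} → n ≤ 3 → (G : WVG n) (i : Fin n) → SS* G i ≤ 6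
SS*≤6 {n} n≤3 G i = begin
  SS* G i          ≤⟨ SS*≤coefficientSum G i ⟩
  coefficientSum i ≡⟨ coefficientSum-small i n≤3 ⟩
  n !              ≤⟨ ∣⇒≤ (m≤n⇒m!∣n! n≤3) ⟩
  3 !              ∎
  where open ≤-Reasoning

-- SS* never equals 7: it is at most 6 for n ≤ 3 and even for n ≥ 4.
SS*≢7 : ∀ {n} (G : WVG n) (i : Fin n) → SS* G i ≢ 7
SS*≢7 {n} G i SS*≡7 with n ≤? 3
... | yes n≤3 = <⇒≢ (s≤s (SS*≤6 n≤3 G i)) SS*≡7
... | no  n≰3 = from-no (2 ∣? 7) (subst (2 ∣_) SS*≡7 (SS*-even (≰⇒> n≰3) G i))

SSstr-values : ∀ x → SSstr x ≡ 0 ⊎ Σ ℕ λ n → Σ (WVG n) λ G → Σ (Fin n) λ i → SSstr x ≡ SS* G i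
SSstr-values x with decodeNats x
... | just (q ∷ j ∷ ws) with j <? length ws
...   | yes j<n = inj₂ (length ws , wvg (fromList ws) q , fromℕ< j<n , refl)
...   | no  _   = inj₁ refl
SSstr-values x | just []       = inj₁ refl
SSstr-values x | just (_ ∷ []) = inj₁ refl
SSstr-values x | nothing       = inj₁ refl

SSstr≢7 : ∀ x → SSstr x ≢ 7
SSstr≢7 x with SSstr-values x
... | inj₁ ≡0                  = λ ≡7 → 0≢1+n (trans (sym ≡0) ≡7)
... | inj₂ (_ , G , i , ≡SS*) = λ ≡7 → SS*≢7 G i (trans (sym ≡SS*) ≡7)

-- A #P-parsimonious-complete function would attain the value 7.
theorem3 : ¬ SharpP-parsimonious-complete SSstr
theorem3 complete with complete⇒onto complete 7
... | x , SSstr≡7 = SSstr≢7 x SSstr≡7
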